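{- Let $n\geq 2$ be an integer and $p\geq 3$ an odd integer. Then the sequence of residues $(s_k(n)\bmod s_{(p-1)/2}(n))_{k\in\mathbb{Z}}$ is periodic with period $p$, and $s_k(n)\equiv 0\pmod{s_{(p-1)/2}(n)}$ if and only if $k\equiv (p-1)/2\pmod p$.
   Context: For an integer $n$, the sequence $(s_k(n))_{k\in\mathbb{Z}}$ is defined by $s_0(n)=1$, $s_1(n)=n+1$ and $s_{k+2}(n)=n\,s_{k+1}(n)-s_k(n)$ for all $k\in\mathbb{Z}$. -}

module Defs where

open import Data.Nat using (ℕ; zero; suc)
open import Data.Integer using (ℤ; +_; -[1+_]; _+_; _*_; _-_; -_)
open import Data.Product using (_×_; _,_; proj₁)

-- Forward pairs: sPos n k = (s_k(n), s_{k+1}(n)) for k ≥ 0.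
sPos : ℤ → ℕ → ℤ × ℤ
sPos n zero = (+ 1 , n + + 1)
sPos n (suc k) with sPos n k
... | (a , b) = (b , n * b - a)

-- Backward pairs: sNeg n m = (s_{-m}(n), s_{-m+1}(n)) for m ≥ 1,
-- using s_k = n s_{k+1} - s_{k+2}.
sNeg : ℤ → ℕ → ℤ × ℤ
sNeg n zero = (+ 1 , n + + 1)
sNeg n (suc m) with sNeg n m
... | (a , b) = (n * a - b , a)

s : ℤ → ℤ → ℤ
s (+ k) n = proj₁ (sPos n k)
s -[1+ m ] n = proj₁ (sNeg n (suc m))

{-# OPTIONS --safe #-}
-- If a two-sided solution of f(k+2) + f(k) = n f(k+1) has f(0) and f(1) divisible
-- by d, then so are all its values. For k ↦ s(m+k) + s(m-k), whose values at 0 and 1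
-- are 2 s(m) and n s(m), this gives s(m+j) ≡ -s(m-j) (mod s(m)); together with
-- s(-1-k) = -s(k) (same argument, d = 0) it yields s(k+2m+1) ≡ s(k). For n ≥ 2 the
-- values s(0) < s(1) < ... are positive, so among the residues 0 ≤ r ≤ 2m only r = m
-- has s(m) ∣ s(r): below m we have 0 < s(r) < s(m), and above m, s(r) ≡ -s(2m-r)
-- with 2m - r < m.
module Submission where

open import Defs
open import Data.Nat using (ℕ; zero; suc; _≤_; _/_; _%_; _∸_; s≤s; z≤n)
import Data.Nat as ℕ
import Data.Nat.Properties as ℕ
import Data.Nat.DivMod as ℕ
open import Data.Nat.Divisibility using (∣⇒≤)
open import Data.Integer using (ℤ; +_; -[1+_]; _+_; _-_; -_; _*_; _<_; +<+) renaming (_≤_ to _ℤ≤_)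
import Data.Integer as ℤ
import Data.Integer.Properties as ℤ
import Data.Integer.DivMod as ℤ
open import Data.Integer.Divisibility using (_∣_)
open import Data.Integer.Divisibility.Signed as Signed
  using (divides; ∣-refl; ∣ᵤ⇒∣; ∣⇒∣ᵤ; ∣m∣n⇒∣m+n; ∣m+n∣n⇒∣m; ∣m+n∣m⇒∣n; ∣n⇒∣m*n; ∣m⇒∣-m;
         0∣⇒≡0)
open import Data.Integer.Tactic.RingSolver using (solve; solve-∀)
open import Algebra.Properties.CommutativeSemigroup ℤ.+-commutativeSemigroup using (interchange)
open import Algebra.Properties.AbelianGroup ℤ.+-0-abelianGroup using (inverseˡ-unique)
open import Data.List using (_∷_; [])
open import Data.Product using (_×_; _,_; proj₁; proj₂)
open import Data.Sum using (inj₁; inj₂)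
open import Data.Empty using (⊥-elim)
open import Relation.Nullary using (¬_)
open import Relation.Binary.Definitions using (tri<; tri≈; tri>)
open import Function.Bundles using (_⇔_; mk⇔)
open import Function.Properties.Equivalence using () renaming (sym to ⇔-sym; trans to ⇔-trans)
open import Relation.Binary.PropositionalEquality
  using (_≡_; refl; sym; trans; cong; cong₂; subst; subst₂; module ≡-Reasoning)

i+[j-i]≡j : ∀ i j → i + (j - i) ≡ j
i+[j-i]≡j = solve-∀

i+j-j≡i : ∀ i j → i + j - j ≡ i
i+j-j≡i = solve-∀

i+i≡2*i : ∀ i → i + i ≡ + 2 * i
i+i≡2*i = solve-∀

-[i-j]≡j-i : ∀ i j → - (i - j) ≡ j - i
-[i-j]≡j-i = solve-∀

i+j-i≡j : ∀ i j → i + j - i ≡ j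
i+j-i≡j = solve-∀

ℤ-induction : (P : ℤ → Set) → P (+ 0) →
              (∀ k → P k → P (k + + 1)) → (∀ k → P (k + + 1) → P k) → ∀ k → P k
ℤ-induction P p₀ up down = go
  where
  go : ∀ k → P k
  go (+ zero)     = p₀
  go (+ suc j)    = subst P (cong +_ (ℕ.+-comm j 1)) (up (+ j) (go (+ j)))
  go -[1+ zero ]  = down -[1+ 0 ] p₀
  go -[1+ suc j ] = down -[1+ suc j ] (go -[1+ j ])

-- The symmetric form of the recurrence is preserved by reflections k ↦ c - k.
record Recurrent (n : ℤ) (f : ℤ → ℤ) : Set where
  constructor recurrent
  field step : ∀ k → f (k + + 2) + f k ≡ n * f (k + + 1)
open Recurrent

s-recurrent : ∀ n → Recurrent n (λ k → s k n)
s-recurrent n = recurrent step′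
  where
  step′ : ∀ k → s (k + + 2) n + s k n ≡ n * s (k + + 1) n
  step′ (+ j) rewrite ℕ.+-comm j 2 | ℕ.+-comm j 1 =
    trans (ℤ.+-comm (n * s (+ suc j) n - s (+ j) n) _) (i+[j-i]≡j (s (+ j) n) (n * s (+ suc j) n))
  step′ -[1+ 0 ]           = i+[j-i]≡j (n + + 1) (n * + 1)
  step′ -[1+ 1 ]           = i+[j-i]≡j (+ 1) (n * s -[1+ 0 ] n)
  step′ -[1+ suc (suc j) ] = i+[j-i]≡j (s -[1+ j ] n) (n * s -[1+ suc j ] n)

module _ {n : ℤ} where

  Recurrent-shift : ∀ {f} c → Recurrent n f → Recurrent n (λ k → f (c + k))
  Recurrent-shift {f} c rec = recurrent λ k → begin
    f (c + (k + + 2)) + f (c + k)  ≡⟨ cong (λ i → f i + f (c + k)) (sym (ℤ.+-assoc c k (+ 2))) ⟩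
    f (c + k + + 2) + f (c + k)    ≡⟨ step rec (c + k) ⟩
    n * f (c + k + + 1)            ≡⟨ cong (λ i → n * f i) (ℤ.+-assoc c k (+ 1)) ⟩
    n * f (c + (k + + 1))          ∎
    where open ≡-Reasoning

  Recurrent-reflect : ∀ {f} c → Recurrent n f → Recurrent n (λ k → f (c - k))
  Recurrent-reflect {f} c rec = recurrent λ k → begin
    f (c - (k + + 2)) + f (c - k)                  ≡⟨ ℤ.+-comm (f (c - (k + + 2))) _ ⟩
    f (c - k) + f (c - (k + + 2))
      ≡⟨ cong (λ i → f i + f (c - (k + + 2))) (solve (c ∷ k ∷ [])) ⟩
    f (c - (k + + 2) + + 2) + f (c - (k + + 2))    ≡⟨ step rec (c - (k + + 2)) ⟩
    n * f (c - (k + + 2) + + 1)                    ≡⟨ cong (λ i → n * f i) (solve (c ∷ k ∷ [])) ⟩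
    n * f (c - (k + + 1))                          ∎
    where open ≡-Reasoning

  Recurrent-+ : ∀ {f g} → Recurrent n f → Recurrent n g → Recurrent n (λ k → f k + g k)
  Recurrent-+ {f} {g} recf recg = recurrent λ k → begin
    f (k + + 2) + g (k + + 2) + (f k + g k)          ≡⟨ interchange (f (k + + 2)) _ _ _ ⟩
    (f (k + + 2) + f k) + (g (k + + 2) + g k)        ≡⟨ cong₂ _+_ (step recf k) (step recg k) ⟩
    n * f (k + + 1) + n * g (k + + 1)                ≡⟨ sym (ℤ.*-distribˡ-+ n _ _) ⟩
    n * (f (k + + 1) + g (k + + 1))                  ∎
    where open ≡-Reasoning

  Recurrent-∣ : ∀ {f d} → Recurrent n f → d Signed.∣ f (+ 0) → d Signed.∣ f (+ 1) →
                ∀ k → d Signed.∣ f k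
  Recurrent-∣ {f} {d} rec d∣f₀ d∣f₁ k =
    proj₁ (ℤ-induction (λ k → d Signed.∣ f k × d Signed.∣ f (k + + 1)) (d∣f₀ , d∣f₁) up down k)
    where
    d∣sum : ∀ k → d Signed.∣ f (k + + 1) → d Signed.∣ f (k + + 2) + f k
    d∣sum k d∣f′ = subst (d Signed.∣_) (sym (step rec k)) (∣n⇒∣m*n n d∣f′)

    up : ∀ k → d Signed.∣ f k × d Signed.∣ f (k + + 1) →
         d Signed.∣ f (k + + 1) × d Signed.∣ f (k + + 1 + + 1)
    up k (d∣f , d∣f′) rewrite ℤ.+-assoc k (+ 1) (+ 1) =
      d∣f′ , ∣m+n∣n⇒∣m (d∣sum k d∣f′) d∣f

    down : ∀ k → d Signed.∣ f (k + + 1) × d Signed.∣ f (k + + 1 + + 1) →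
           d Signed.∣ f k × d Signed.∣ f (k + + 1)
    down k (d∣f′ , d∣f″) rewrite ℤ.+-assoc k (+ 1) (+ 1) =
      ∣m+n∣m⇒∣n (d∣sum k d∣f′) d∣f″ , d∣f′

  Recurrent-zero : ∀ {f} → Recurrent n f → f (+ 0) ≡ + 0 → f (+ 1) ≡ + 0 → ∀ k → f k ≡ + 0
  Recurrent-zero rec f₀≡0 f₁≡0 k = 0∣⇒≡0 (Recurrent-∣ rec (0∣ f₀≡0) (0∣ f₁≡0) k)
    where
    0∣ : ∀ {i} → i ≡ + 0 → + 0 Signed.∣ i
    0∣ refl = ∣-refl

  Recurrent-ℕ : ∀ {f} → Recurrent n f → ∀ j → f (+ suc (suc j)) + f (+ j) ≡ n * f (+ suc j)
  Recurrent-ℕ rec j rewrite sym (ℕ.+-comm j 2) | sym (ℕ.+-comm j 1) = step rec (+ j)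

  module _ (2≤n : + 2 ℤ≤ n) {f} (rec : Recurrent n f)
           (0<f₀ : + 0 < f (+ 0)) (f₀<f₁ : f (+ 0) < f (+ 1)) where

    Recurrent-increasing : ∀ j → + 0 < f (+ j) × f (+ j) < f (+ suc j)
    Recurrent-increasing zero = 0<f₀ , f₀<f₁
    Recurrent-increasing (suc j) with Recurrent-increasing j
    ... | 0<a , a<b =
      ℤ.<-trans 0<a a<b , subst₂ _<_ (i+j-j≡i b a) (i+j-j≡i c a) (ℤ.+-monoˡ-< (- a) b+a<c+a)
      where
      a = f (+ j)
      b = f (+ suc j)
      c = f (+ suc (suc j))
      open ℤ.≤-Reasoning
      b+a<c+a : b + a < c + a
      b+a<c+a = begin-strict
        b + a    <⟨ ℤ.+-monoʳ-< b a<b ⟩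
        b + b    ≡⟨ i+i≡2*i b ⟩
        + 2 * b  ≤⟨ ℤ.*-monoʳ-≤-nonNeg b {{ℤ.nonNegative (ℤ.<⇒≤ (ℤ.<-trans 0<a a<b))}} 2≤n ⟩
        n * b    ≡⟨ sym (Recurrent-ℕ rec j) ⟩
        c + a    ∎

    Recurrent-strictly-increasing : ∀ {i} j → i ℕ.< j → f (+ i) < f (+ j)
    Recurrent-strictly-increasing (suc j) (s≤s i≤j) with ℕ.m≤n⇒m<n∨m≡n i≤j
    ... | inj₁ i<j  = ℤ.<-trans (Recurrent-strictly-increasing j i<j) (proj₂ (Recurrent-increasing j))
    ... | inj₂ refl = proj₂ (Recurrent-increasing j)

-- A record rather than a synonym for d ∣ a - b, so that a, b and d are inferable.
infix 4 _≡_mod_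
record _≡_mod_ (a b d : ℤ) : Set where
  constructor ≡-mod
  field ∣-difference : d Signed.∣ a - b
open _≡_mod_

module _ {d : ℤ} where

  ≡-mod-refl : ∀ {a} → a ≡ a mod d
  ≡-mod-refl {a} =
    ≡-mod (subst (d Signed.∣_) (sym (ℤ.+-inverseʳ a)) (divides (+ 0) (sym (ℤ.*-zeroˡ d))))

  ≡-mod-sym : ∀ {a b} → a ≡ b mod d → b ≡ a mod d
  ≡-mod-sym {a} {b} (≡-mod d∣a-b) = ≡-mod (subst (d Signed.∣_) (-[i-j]≡j-i a b) (∣m⇒∣-m d∣a-b))

  ≡-mod-trans : ∀ {a b c} → a ≡ b mod d → b ≡ c mod d → a ≡ c mod d
  ≡-mod-trans {a} {b} {c} (≡-mod d∣a-b) (≡-mod d∣b-c) =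
    ≡-mod (subst (d Signed.∣_) (ℤ.+-minus-telescope a b c) (∣m∣n⇒∣m+n d∣a-b d∣b-c))

  ≡-mod-∣ : ∀ {a b} → a ≡ b mod d → d Signed.∣ b → d Signed.∣ a
  ≡-mod-∣ {a} {b} (≡-mod d∣a-b) d∣b = subst (d Signed.∣_) (i+[j-i]≡j b a) (∣m∣n⇒∣m+n d∣b d∣a-b)

  ≡-mod-periodic : ∀ {P} (f : ℤ → ℤ) → (∀ k → f (k + P) ≡ f k mod d) →
                   ∀ t k → f (k + t * P) ≡ f k mod d
  ≡-mod-periodic {P} f period = ℤ-induction (λ t → ∀ k → f (k + t * P) ≡ f k mod d) base up down
    where
    base : ∀ k → f (k + + 0 * P) ≡ f k mod d
    base k = subst (λ i → f i ≡ f k mod d) (sym (ℤ.+-identityʳ k)) ≡-mod-refl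

    one-more-period : ∀ t k → k + (t + + 1) * P ≡ k + t * P + P
    one-more-period t k = solve (t ∷ k ∷ P ∷ [])

    up : ∀ t → (∀ k → f (k + t * P) ≡ f k mod d) → ∀ k → f (k + (t + + 1) * P) ≡ f k mod d
    up t hyp k rewrite one-more-period t k = ≡-mod-trans (period (k + t * P)) (hyp k)

    down : ∀ t → (∀ k → f (k + (t + + 1) * P) ≡ f k mod d) → ∀ k → f (k + t * P) ≡ f k mod d
    down t hyp k = ≡-mod-trans (≡-mod-sym (period (k + t * P)))
                               (subst (λ i → f i ≡ f k mod d) (one-more-period t k) (hyp k))

0<i<d⇒d∤i : ∀ {d i} → + 0 < i → i < d → ¬ d Signed.∣ i
0<i<d⇒d∤i {+ d} {+ suc i} _ (+<+ i<d) d∣i = ℕ.<⇒≱ i<d (∣⇒≤ (∣⇒∣ᵤ d∣i))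
0<i<d⇒d∤i {i = + zero} (+<+ ())

module _ (n : ℤ) where

  s[-1-k]≡-sₖ : ∀ k → s (- + 1 - k) n ≡ - s k n
  s[-1-k]≡-sₖ k = inverseˡ-unique _ _ (Recurrent-zero sum-recurrent (sum₀ n) (sum₁ n) k)
    where
    sum₀ : ∀ x → x * + 1 - (x + + 1) + + 1 ≡ + 0
    sum₀ = solve-∀
    sum₁ : ∀ x → x * (x * + 1 - (x + + 1)) - + 1 + (x + + 1) ≡ + 0
    sum₁ = solve-∀
    sum-recurrent : Recurrent n (λ k → s (- + 1 - k) n + s k n)
    sum-recurrent = Recurrent-+ (Recurrent-reflect (- + 1) (s-recurrent n)) (s-recurrent n)

  sₘ∣s[m+j]+s[m-j] : ∀ m j → s m n Signed.∣ s (m + j) n + s (m - j) n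
  sₘ∣s[m+j]+s[m-j] m =
    Recurrent-∣ (Recurrent-+ (Recurrent-shift m (s-recurrent n)) (Recurrent-reflect m (s-recurrent n)))
    (subst (λ i → s m n Signed.∣ s i n + s i n) (sym (ℤ.+-identityʳ m)) (∣m∣n⇒∣m+n ∣-refl ∣-refl))
    (subst (s m n Signed.∣_) neighbours (∣n⇒∣m*n n ∣-refl))
    where
    open ≡-Reasoning
    m≡m-1+1 : m ≡ m - + 1 + + 1
    m≡m-1+1 = solve (m ∷ [])
    m-1+2≡m+1 : m - + 1 + + 2 ≡ m + + 1
    m-1+2≡m+1 = solve (m ∷ [])
    neighbours : n * s m n ≡ s (m + + 1) n + s (m - + 1) n
    neighbours = begin
      n * s m n                                ≡⟨ cong (λ i → n * s i n) m≡m-1+1 ⟩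
      n * s (m - + 1 + + 1) n                  ≡⟨ sym (step (s-recurrent n) (m - + 1)) ⟩
      s (m - + 1 + + 2) n + s (m - + 1) n      ≡⟨ cong (λ i → s i n + s (m - + 1) n) m-1+2≡m+1 ⟩
      s (m + + 1) n + s (m - + 1) n            ∎

  s-periodic : ∀ m k → s (k + (+ 1 + (m + m))) n ≡ s k n mod s m n
  s-periodic m k = ≡-mod (subst (s m n Signed.∣_) pair≡difference (sₘ∣s[m+j]+s[m-j] m (k + m + + 1)))
    where
    pair≡difference : s (m + (k + m + + 1)) n + s (m - (k + m + + 1)) n
                    ≡ s (k + (+ 1 + (m + m))) n - s k n
    pair≡difference = cong₂ _+_ (cong (λ i → s i n) m+j≡k+p)
                                (trans (cong (λ i → s i n) m-j≡-1-k) (s[-1-k]≡-sₖ k))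
      where
      m+j≡k+p : m + (k + m + + 1) ≡ k + (+ 1 + (m + m))
      m+j≡k+p = solve (m ∷ k ∷ [])
      m-j≡-1-k : m - (k + m + + 1) ≡ - + 1 - k
      m-j≡-1-k = solve (m ∷ k ∷ [])

module _ {n : ℤ} (2≤n : + 2 ℤ≤ n) where

  private
    0<s₀ : + 0 < s (+ 0) n
    0<s₀ = +<+ (s≤s z≤n)

    s₀<s₁ : s (+ 0) n < s (+ 1) n
    s₀<s₁ = ℤ.+-monoˡ-< (+ 1) (ℤ.<-≤-trans (+<+ (s≤s z≤n)) 2≤n)

  s-positive : ∀ j → + 0 < s (+ j) n
  s-positive j = proj₁ (Recurrent-increasing 2≤n (s-recurrent n) 0<s₀ s₀<s₁ j)

  s-strictly-increasing : ∀ {i} j → i ℕ.< j → s (+ i) n < s (+ j) n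
  s-strictly-increasing = Recurrent-strictly-increasing 2≤n (s-recurrent n) 0<s₀ s₀<s₁

  module _ (m : ℕ) where

    sₘ∣sᵣ⇒r≡m : ∀ r → r ℕ.< suc (m ℕ.+ m) → s (+ m) n Signed.∣ s (+ r) n → r ≡ m
    sₘ∣sᵣ⇒r≡m r r<p sₘ∣sᵣ with ℕ.<-cmp r m
    ... | tri< r<m _ _ = ⊥-elim (0<i<d⇒d∤i (s-positive r) (s-strictly-increasing m r<m) sₘ∣sᵣ)
    ... | tri≈ _ r≡m _ = r≡m
    -- Here r = m + 1 + i and m = 1 + i + j, so reflecting about m pairs s(r) with s(j), j < m.
    ... | tri> _ _ m<r with ℕ.m≤n⇒∃[o]m+o≡n m<r
    ...   | i , refl with ℕ.m≤n⇒∃[o]m+o≡n (ℕ.+-cancelˡ-< m i m (ℕ.≤-pred r<p))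
    ...     | j , refl = ⊥-elim (0<i<d⇒d∤i (s-positive j) sⱼ<sₘ sₘ∣sⱼ)
      where
      sⱼ<sₘ : s (+ j) n < s (+ m) n
      sⱼ<sₘ = s-strictly-increasing (suc i ℕ.+ j) (ℕ.m<n+m j (s≤s z≤n))
      sₘ∣sⱼ : s (+ m) n Signed.∣ s (+ j) n
      sₘ∣sⱼ = ∣m+n∣m⇒∣n (subst (s (+ m) n Signed.∣_) pair≡sᵣ+sⱼ (sₘ∣s[m+j]+s[m-j] n (+ m) (+ suc i)))
                        sₘ∣sᵣ
        where
        pair≡sᵣ+sⱼ : s (+ m + + suc i) n + s (+ m - + suc i) n ≡ s (+ suc (m ℕ.+ i)) n + s (+ j) n
        pair≡sᵣ+sⱼ = cong₂ (λ a b → s a n + s b n) (cong +_ (ℕ.+-suc m i)) (i+j-i≡j (+ suc i) (+ j))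

    sₘ∣sₖ⇔p∣k-m : ∀ k → s (+ m) n Signed.∣ s k n ⇔ + suc (m ℕ.+ m) Signed.∣ k - + m
    sₘ∣sₖ⇔p∣k-m k = mk⇔ to from
      where
      p = + suc (m ℕ.+ m)

      to : s (+ m) n Signed.∣ s k n → p Signed.∣ k - + m
      to sₘ∣sₖ = divides q k-m≡qp
        where
        r = k ℤ.% p
        q = k ℤ./ p
        k≡r+qp : k ≡ + r + q * p
        k≡r+qp = ℤ.a≡a%n+[a/n]*n k p
        sₘ∣sᵣ : s (+ m) n Signed.∣ s (+ r) n
        sₘ∣sᵣ = ≡-mod-∣ (≡-mod-sym (≡-mod-periodic (λ i → s i n) (s-periodic n (+ m)) q (+ r)))
                        (subst (λ i → s (+ m) n Signed.∣ s i n) k≡r+qp sₘ∣sₖ)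
        r≡m : r ≡ m
        r≡m = sₘ∣sᵣ⇒r≡m r (ℤ.n%d<d k p) sₘ∣sᵣ
        open ≡-Reasoning
        k-m≡qp : k - + m ≡ q * p
        k-m≡qp = begin
          k - + m                ≡⟨ cong (_- + m) k≡r+qp ⟩
          + r + q * p - + m      ≡⟨ cong (λ x → + x + q * p - + m) r≡m ⟩
          + m + q * p - + m      ≡⟨ i+j-i≡j (+ m) (q * p) ⟩
          q * p                  ∎

      from : p Signed.∣ k - + m → s (+ m) n Signed.∣ s k n
      from (divides t k-m≡tp) = subst (λ i → s (+ m) n Signed.∣ s i n) m+tp≡k
        (≡-mod-∣ (≡-mod-periodic (λ i → s i n) (s-periodic n (+ m)) t (+ m)) ∣-refl)
        where
        m+tp≡k : + m + t * p ≡ k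
        m+tp≡k = trans (cong (λ x → + m + x) (sym k-m≡tp)) (i+[j-i]≡j (+ m) k)

odd⇒≡1+2*half : ∀ p → p % 2 ≡ 1 → p ≡ suc ((p ∸ 1) / 2 ℕ.+ (p ∸ 1) / 2)
odd⇒≡1+2*half p p%2≡1 = begin
  p                                    ≡⟨ p≡1+q*2 ⟩
  suc (q ℕ.* 2)                        ≡⟨ cong suc (ℕ.*-comm q 2) ⟩
  suc (q ℕ.+ (q ℕ.+ 0))                ≡⟨ cong (λ x → suc (q ℕ.+ x)) (ℕ.+-identityʳ q) ⟩
  suc (q ℕ.+ q)                        ≡⟨ cong (λ x → suc (x ℕ.+ x)) half≡q ⟨
  suc ((p ∸ 1) / 2 ℕ.+ (p ∸ 1) / 2)    ∎
  where
  open ≡-Reasoning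
  q = p / 2
  p≡1+q*2 : p ≡ suc (q ℕ.* 2)
  p≡1+q*2 = trans (ℕ.m≡m%n+[m/n]*n p 2) (cong (ℕ._+ q ℕ.* 2) p%2≡1)
  half≡q : (p ∸ 1) / 2 ≡ q
  half≡q = trans (cong (λ x → (x ∸ 1) / 2) p≡1+q*2) (ℕ.m*n/n≡m q 2)

∣ᵤ⇔∣ : ∀ {k i} → k ∣ i ⇔ k Signed.∣ i
∣ᵤ⇔∣ = mk⇔ ∣ᵤ⇒∣ ∣⇒∣ᵤ

lemma27 : (n : ℤ) → + 2 ℤ≤ n → (p : ℕ) → 3 ≤ p → p % 2 ≡ 1 →
    ((k : ℤ) → s (+ ((p ∸ 1) / 2)) n ∣ (s (k + + p) n - s k n))
    × ((k : ℤ) → (s (+ ((p ∸ 1) / 2)) n ∣ s k n) ⇔ (+ p ∣ (k - + ((p ∸ 1) / 2))))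
lemma27 n 2≤n p _ p-odd = subst Claim (sym (odd⇒≡1+2*half p p-odd))
  ( (λ k → ∣⇒∣ᵤ (∣-difference (s-periodic n (+ m) k)))
  , (λ k → ⇔-trans ∣ᵤ⇔∣ (⇔-trans (sₘ∣sₖ⇔p∣k-m 2≤n m k) (⇔-sym ∣ᵤ⇔∣))))
  where
  m = (p ∸ 1) / 2
  Claim : ℕ → Set
  Claim p′ = ((k : ℤ) → s (+ m) n ∣ (s (k + + p′) n - s k n))
           × ((k : ℤ) → (s (+ m) n ∣ s k n) ⇔ (+ p′ ∣ (k - + m)))
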